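{- For all integers $m,n\ge 0$ with $m+n\ge 1$, we have $.M.(m+1,n+1)\ge .M.(m,n)+2$.
   Context: $.M.(m,n)$ is Knuth's unconstrained restricted-adversary function, defined for integers $m,n\ge0$ as follows (it is the special case $\lambda=\rho=.$ of a family $\lambda M\rho$). Consider sorted lists $a_1<\cdots<a_m$ and $b_1<\cdots<b_n$ (all elements distinct, interleaving unknown). Constraint symbols: left constraint $\lambda$: "." none, "$\backslash$" known $a_1<b_1$, "/" known $a_1>b_1$; right constraint $\rho$: "." none, "$\backslash$" known $a_m<b_n$, "/" known $a_m>b_n$; a constraint on a problem with an empty list is vacuous; $\lambda M\rho(m,n)$ is defined when some interleaving satisfies the constraints. Its value is $0$ if the constraints determine the interleaving (in particular if $m=0$ or $n=0$); otherwise $\lambda M\rho(m,n)=\min_{i,j}\lambda M_{i,j}\rho(m,n)$ with $\lambda M_{i,j}\rho(m,n)=1+\max$ over admissible splittings for the comparison $a_i$ vs $b_j$ of the sum of the two subproblem values. Splittings: (S) $0\le p\le m$, $0\le q\le n$, subproblems $(a_1..a_p;b_1..b_q)$ below $(a_{p+1}..a_m;b_{q+1}..b_n)$, values $\lambda M.(p,q)+.M\rho(m-p,n-q)$; (A) $1\le k\le m$, $1\le q\le n-1$, $b_q<a_k<b_{q+1}$, subproblems $(a_1..a_k;b_1..b_q)$ and $(a_k..a_m;b_{q+1}..b_n)$, values $\lambda M/(k,q)+\backslash M\rho(m-k+1,n-q)$; (B) $1\le p\le m-1$, $1\le l\le n$, $a_p<b_l<a_{p+1}$, subproblems $(a_1..a_p;b_1..b_l)$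 and $(a_{p+1}..a_m;b_l..b_n)$, values $\lambda M\backslash(p,l)+/M\rho(m-p,n-l+1)$. A splitting is admissible if $a_i$ and $b_j$ lie in different subproblems (neither is the shared element) and some interleaving satisfies the splitting's relations together with $\lambda,\rho$. -}

module Defs where

open import Data.Nat using (ℕ; zero; suc; _+_; _∸_; _⊓_; _⊔_; _≤ᵇ_; _<ᵇ_; _≡ᵇ_)
open import Data.Bool using (Bool; true; false; _∧_; _∨_; not; if_then_else_)
open import Data.List using (List; []; _∷_; _++_; map; concatMap; foldr; upTo; replicate)
open import Data.Bool.ListAction using (any)

-- Constraint symbols:  none = ".",  lt = "\" (a-side smaller),  gt = "/" (a-side larger).
-- Left constraint:  lt : a₁ < b₁ ,  gt : a₁ > b₁.
-- Right constraint: lt : a_m < b_n , gt : a_m > b_n.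
data Con : Set where
  none lt gt : Con

-- An interleaving of a₁<…<a_m and b₁<…<b_n is represented by the word
-- (in increasing order) of its elements, with  true = some a,  false = some b.
interleavings : ℕ → ℕ → List (List Bool)
interleavings zero n = replicate n false ∷ []
interleavings (suc m) zero = replicate (suc m) true ∷ []
interleavings (suc m) (suc n) =
  map (true ∷_) (interleavings m (suc n)) ++ map (false ∷_) (interleavings (suc m) n)

eqB : Bool → Bool → Bool
eqB true y = y
eqB false y = not y

headIs : Bool → List Bool → Bool
headIs x [] = false
headIs x (y ∷ _) = eqB x y

lastIs : Bool → List Bool → Bool
lastIs x [] = false
lastIs x (y ∷ []) = eqB x y
lastIs x (_ ∷ y ∷ ys) = lastIs x (y ∷ ys)

vacuous : ℕ → ℕ → Bool
vacuous m n = (m ≡ᵇ 0) ∨ (n ≡ᵇ 0)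

leftOK : Con → ℕ → ℕ → List Bool → Bool
leftOK none m n w = true
leftOK lt m n w = vacuous m n ∨ headIs true w
leftOK gt m n w = vacuous m n ∨ headIs false w

rightOK : Con → ℕ → ℕ → List Bool → Bool
rightOK none m n w = true
rightOK lt m n w = vacuous m n ∨ lastIs false w
rightOK gt m n w = vacuous m n ∨ lastIs true w

sat : Con → Con → ℕ → ℕ → List Bool → Bool
sat l r m n w = leftOK l m n w ∧ rightOK r m n w

countSat : Con → Con → ℕ → ℕ → ℕ
countSat l r m n = foldr (λ w c → if sat l r m n w then suc c else c) 0 (interleavings m n)

admissibleWord : Con → Con → ℕ → ℕ → (List Bool → List Bool → List Bool)
               → ℕ → ℕ → ℕ → ℕ → Bool
admissibleWord l r m n glue p q p' q' =
  any (λ u → any (λ v → sat l r m n (glue u v)) (interleavings p' q')) (interleavings p q)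

maxList : List ℕ → ℕ
maxList = foldr _⊔_ 0

minList : List ℕ → ℕ
minList [] = 0
minList (x ∷ xs) = foldr _⊓_ x xs

from1 : ℕ → List ℕ
from1 k = map suc (upTo k)

from0 : ℕ → List ℕ
from0 k = upTo (suc k)

-- Knuth's restricted-adversary function λMρ(m,n), computed with fuel.
-- All subproblems of an (m,n)-problem have strictly smaller m+n, so fuel m+n suffices.
Mf : ℕ → Con → Con → ℕ → ℕ → ℕ
Mf zero l r m n = 0
Mf (suc f) l r m n =
  if countSat l r m n ≤ᵇ 1 then 0
  else minList (concatMap (λ i → map (λ j → suc (maxList (cands i j))) (from1 n)) (from1 m))
  where
  -- splitting (S): (a₁..a_p; b₁..b_q) below (a_{p+1}..a_m; b_{q+1}..b_n)
  candS : ℕ → ℕ → ℕ → ℕ → List ℕ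
  candS i j p q =
    if (((i ≤ᵇ p) ∧ (q <ᵇ j)) ∨ ((p <ᵇ i) ∧ (j ≤ᵇ q)))
       ∧ admissibleWord l r m n _++_ p q (m ∸ p) (n ∸ q)
    then Mf f l none p q + Mf f none r (m ∸ p) (n ∸ q) ∷ []
    else []
  -- splitting (A): b_q < a_k < b_{q+1}; shared element a_k
  candA : ℕ → ℕ → ℕ → ℕ → List ℕ
  candA i j k q =
    if (((i <ᵇ k) ∧ (q <ᵇ j)) ∨ ((k <ᵇ i) ∧ (j ≤ᵇ q)))
       ∧ admissibleWord l r m n (λ u v → u ++ (true ∷ v)) (k ∸ 1) q (m ∸ k) (n ∸ q)
    then Mf f l gt k q + Mf f lt r (suc (m ∸ k)) (n ∸ q) ∷ []
    else []
  -- splitting (B): a_p < b_l < a_{p+1}; shared element b_l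
  candB : ℕ → ℕ → ℕ → ℕ → List ℕ
  candB i j p k =
    if (((i ≤ᵇ p) ∧ (k <ᵇ j)) ∨ ((p <ᵇ i) ∧ (j <ᵇ k)))
       ∧ admissibleWord l r m n (λ u v → u ++ (false ∷ v)) p (k ∸ 1) (m ∸ p) (n ∸ k)
    then Mf f l lt p k + Mf f gt r (m ∸ p) (suc (n ∸ k)) ∷ []
    else []
  cands : ℕ → ℕ → List ℕ
  cands i j =
    concatMap (λ p → concatMap (λ q → candS i j p q) (from0 n)) (from0 m)
    ++ concatMap (λ k → concatMap (λ q → candA i j k q) (from1 (n ∸ 1))) (from1 m)
    ++ concatMap (λ p → concatMap (λ k → candB i j p k) (from1 n)) (from1 (m ∸ 1))

M : Con → Con → ℕ → ℕ → ℕ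
M l r m n = Mf (m + n) l r m n

-- For every comparison a_i : b_j of the (m + 1, n + 1) problem we exhibit an admissible
-- splitting worth at least .M.(m, n) + 1. If i ≤ m and j ≤ n, take a splitting of largest
-- value for a_i : b_j in the (m, n) problem and add a_{m+1}, b_{n+1} to its upper part, which
-- gains 2 by induction on m + n; if i, j ≥ 2, add a₁, b₁ to the lower part of the best
-- splitting for a_{i-1} : b_{j-1} instead; a₁ : b_{n+1} and a_{m+1} : b₁ split off a 1 × 1
-- problem next to the (m, n) one. Splittings (A) and (B) of the smaller problem become
-- splittings (S) of the larger one, which costs nothing because relaxing a constraint never
-- decreases M and a known minimum (a₁ < b₁ or a₁ > b₁) can be removed without increasing M.

module Submission where

open import Defs
open import Data.Nat using (ℕ; zero; suc; _+_; _∸_; _≤_; _<_; z≤n; s≤s; s≤s⁻¹; _⊓_; _⊔_; _≤ᵇ_; _<ᵇ_)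
open import Data.Nat.Properties
open import Data.Nat.Induction using (<-wellFounded)
open import Induction.WellFounded using (Acc; acc)
open import Data.Bool using (Bool; true; false; _∧_; _∨_; if_then_else_; T)
open import Data.Bool.Properties using (T-∧; T-∨; T-≡)
open import Data.List using (List; []; _∷_; _++_; map; concatMap; foldr; replicate)
open import Data.List.Properties using (++-conicalˡ)
open import Data.List.Membership.Propositional using (_∈_; find; lose)
open import Data.List.Membership.Propositional.Properties
  using (∈-map⁺; ∈-map⁻; ∈-++⁺ˡ; ∈-++⁺ʳ; ∈-++⁻; ∈-concatMap⁺; ∈-concatMap⁻; ∈-upTo⁺; ∈-upTo⁻)
open import Data.List.Relation.Unary.Any using (here; there)
open import Data.List.Relation.Unary.Any.Properties using (any⁺; any⁻)
open import Data.Product using (∃₂; ∃-syntax; _×_; _,_; proj₁; proj₂; map₁; map₂)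
  renaming (map to ×-map)
open import Data.Sum using (_⊎_; inj₁; inj₂; [_,_]′) renaming (map to ⊎-map)
open import Data.Empty using (⊥; ⊥-elim)
open import Function using (id; _∘_; _⇔_; mk⇔; Equivalence)
open import Relation.Nullary using (¬_)
open import Function.Properties.Equivalence using () renaming (trans to ⇔-trans)
open import Data.Product.Function.NonDependent.Propositional using (_×-⇔_)
open import Data.Sum.Function.Propositional using (_⊎-⇔_)
open import Relation.Binary.PropositionalEquality

open Equivalence using (to; from)

≤-maxList : ∀ {x xs} → x ∈ xs → x ≤ maxList xs
≤-maxList {xs = y ∷ ys} (here refl) = m≤m⊔n y (maxList ys)
≤-maxList {xs = y ∷ ys} (there x∈)  = ≤-trans (≤-maxList x∈) (m≤n⊔m y (maxList ys))

maxList-≤ : ∀ {K} xs → (∀ {x} → x ∈ xs → x ≤ K) → maxList xs ≤ K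
maxList-≤ []       _ = z≤n
maxList-≤ (y ∷ ys) h = ⊔-lub (h (here refl)) (maxList-≤ ys (h ∘ there))

maxList-∈ : ∀ {x xs} → x ∈ xs → maxList xs ∈ xs
maxList-∈ {xs = y ∷ ys} _ with ⊔-sel y (maxList ys)
... | inj₁ eq = here eq
maxList-∈ {xs = y ∷ []}     _ | inj₂ eq = here (⊔-identityʳ y)
maxList-∈ {xs = y ∷ z ∷ zs} _ | inj₂ eq = subst (_∈ y ∷ z ∷ zs) (sym eq) (there (maxList-∈ (here refl)))

foldr-⊓-≤ : ∀ y ys → foldr _⊓_ y ys ≤ y
foldr-⊓-≤ y []       = ≤-refl
foldr-⊓-≤ y (z ∷ zs) = ≤-trans (m⊓n≤n z _) (foldr-⊓-≤ y zs)

foldr-⊓-≤-∈ : ∀ y {x} ys → x ∈ ys → foldr _⊓_ y ys ≤ x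
foldr-⊓-≤-∈ y (z ∷ zs) (here refl) = m⊓n≤m z _
foldr-⊓-≤-∈ y (z ∷ zs) (there x∈)  = ≤-trans (m⊓n≤n z _) (foldr-⊓-≤-∈ y zs x∈)

foldr-⊓-∈ : ∀ y ys → foldr _⊓_ y ys ∈ y ∷ ys
foldr-⊓-∈ y []       = here refl
foldr-⊓-∈ y (z ∷ zs) with ⊓-sel z (foldr _⊓_ y zs) | foldr-⊓-∈ y zs
... | inj₁ eq | _          = there (here eq)
... | inj₂ eq | here eq′   = here (trans eq eq′)
... | inj₂ eq | there min∈ = there (there (subst (_∈ zs) (sym eq) min∈))

minList-≤ : ∀ {x xs} → x ∈ xs → minList xs ≤ x
minList-≤ {xs = y ∷ ys} (here refl) = foldr-⊓-≤ y ys
minList-≤ {xs = y ∷ ys} (there x∈)  = foldr-⊓-≤-∈ y ys x∈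

minList-∈ : ∀ {x xs} → x ∈ xs → minList xs ∈ xs
minList-∈ {xs = y ∷ ys} _ = foldr-⊓-∈ y ys

∈-concatMap²⁻ : ∀ {A B C : Set} {f : A → B → List C} {as bs y} →
                y ∈ concatMap (λ a → concatMap (f a) bs) as →
                ∃₂ λ a b → a ∈ as × b ∈ bs × y ∈ f a b
∈-concatMap²⁻ {f = f} {as} {bs} y∈ =
  let a , a∈ , y∈′ = find (∈-concatMap⁻ (λ a → concatMap (f a) bs) {xs = as} y∈)
      b , b∈ , y∈″ = find (∈-concatMap⁻ (f a) {xs = bs} y∈′)
  in a , b , a∈ , b∈ , y∈″

∈-concatMap²⁺ : ∀ {A B C : Set} {f : A → B → List C} {as bs a b y} →
                a ∈ as → b ∈ bs → y ∈ f a b → y ∈ concatMap (λ a → concatMap (f a) bs) as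
∈-concatMap²⁺ {f = f} {bs = bs} a∈ b∈ y∈ =
  ∈-concatMap⁺ (λ a → concatMap (f a) bs) (lose a∈ (∈-concatMap⁺ (f _) (lose b∈ y∈)))

∈-if⁻ : ∀ {A : Set} {b} {x y : A} → x ∈ (if b then y ∷ [] else []) → T b × x ≡ y
∈-if⁻ {b = true} (here x≡y) = _ , x≡y

∈-if⁺ : ∀ {A : Set} {b} {y : A} → T b → y ∈ (if b then y ∷ [] else [])
∈-if⁺ {b = true} _ = here refl

++∷≢[] : ∀ {A : Set} (t : List A) x v → t ++ x ∷ v ≢ []
++∷≢[] []      x v ()
++∷≢[] (y ∷ t) x v ()

record _∈[1,_] (i m : ℕ) : Set where
  constructor _,_
  field
    1≤ : 1 ≤ i
    ≤m : i ≤ m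

open _∈[1,_] using (1≤; ≤m)

∈-from0⁻ : ∀ {m p} → p ∈ from0 m → p ≤ m
∈-from0⁻ = s≤s⁻¹ ∘ ∈-upTo⁻

∈-from0⁺ : ∀ {m p} → p ≤ m → p ∈ from0 m
∈-from0⁺ = ∈-upTo⁺ ∘ s≤s

∈-from1⁻ : ∀ {m p} → p ∈ from1 m → p ∈[1, m ]
∈-from1⁻ p∈ with _ , p∈′ , refl ← ∈-map⁻ suc p∈ = s≤s z≤n , ∈-upTo⁻ p∈′

∈-from1⁺ : ∀ {m p} → p ∈[1, m ] → p ∈ from1 m
∈-from1⁺ {p = suc p} (_ , p≤m) = ∈-map⁺ suc (∈-upTo⁺ p≤m)

∈-from1-∸1⁻ : ∀ {m p} → p ∈ from1 (m ∸ 1) → 1 ≤ p × p < m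
∈-from1-∸1⁻ {suc m} p∈ = let 1≤p , p≤m = ∈-from1⁻ p∈ in 1≤p , s≤s p≤m
∈-from1-∸1⁻ {zero} ()

∈-from1-∸1⁺ : ∀ {m p} → 1 ≤ p → p < m → p ∈ from1 (m ∸ 1)
∈-from1-∸1⁺ {suc m} 1≤p p<m = ∈-from1⁺ (1≤p , s≤s⁻¹ p<m)

1≤m+1+n : ∀ m n → 1 ≤ m + suc n
1≤m+1+n m n = ≤-trans (s≤s z≤n) (m≤n+m (suc n) m)

m<n≤1+o⇒m≤o : ∀ {m n o} → m < n → n ≤ suc o → m ≤ o
m<n≤1+o⇒m≤o m<n n≤1+o = s≤s⁻¹ (≤-trans m<n n≤1+o)

+-mono-≤+2ʳ : ∀ {a a′ b b′} → a ≤ a′ → b + 2 ≤ b′ → 2 + (a + b) ≤ a′ + b′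
+-mono-≤+2ʳ {a} {a′} {b} {b′} a≤ b+2≤ = begin
  2 + (a + b) ≡⟨ +-comm 2 (a + b) ⟩
  a + b + 2   ≡⟨ +-assoc a b 2 ⟩
  a + (b + 2) ≤⟨ +-mono-≤ a≤ b+2≤ ⟩
  a′ + b′     ∎
  where open ≤-Reasoning

+-mono-≤+2ˡ : ∀ {a a′ b b′} → a + 2 ≤ a′ → b ≤ b′ → 2 + (a + b) ≤ a′ + b′
+-mono-≤+2ˡ {a} {a′} {b} {b′} a+2≤ b≤ = begin
  2 + (a + b) ≡⟨ +-assoc 2 a b ⟨
  2 + a + b   ≡⟨ cong (_+ b) (+-comm 2 a) ⟩
  a + 2 + b   ≤⟨ +-mono-≤ a+2≤ b≤ ⟩
  a′ + b′     ∎
  where open ≤-Reasoning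

-- Interleavings and constraints

true∷∈⁺ : ∀ {a b t} → t ∈ interleavings a b → true ∷ t ∈ interleavings (suc a) b
true∷∈⁺ {zero}  {zero}  (here refl) = here refl
true∷∈⁺ {suc a} {zero}  (here refl) = here refl
true∷∈⁺ {a}     {suc b} t∈          = ∈-++⁺ˡ (∈-map⁺ (true ∷_) t∈)

false∷∈⁺ : ∀ {a b t} → t ∈ interleavings a b → false ∷ t ∈ interleavings a (suc b)
false∷∈⁺ {zero}  (here refl) = here refl
false∷∈⁺ {suc a} {b} t∈      = ∈-++⁺ʳ (map (true ∷_) (interleavings a (suc b))) (∈-map⁺ (false ∷_) t∈)

true∷∈⁻ : ∀ {a b t} → true ∷ t ∈ interleavings (suc a) b → t ∈ interleavings a b
true∷∈⁻ {zero}  {zero}  (here refl) = here refl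
true∷∈⁻ {suc a} {zero}  (here refl) = here refl
true∷∈⁻ {a}     {suc b} t∈ with ∈-++⁻ (map (true ∷_) (interleavings a (suc b))) t∈
... | inj₁ t∈ˡ with _ , t∈′ , refl ← ∈-map⁻ (true ∷_) t∈ˡ = t∈′
... | inj₂ t∈ʳ with _ , _ , () ← ∈-map⁻ (false ∷_) t∈ʳ

false∷∈⁻ : ∀ {a b t} → false ∷ t ∈ interleavings a (suc b) → t ∈ interleavings a b
false∷∈⁻ {zero}  (here refl) = here refl
false∷∈⁻ {suc a} {b} t∈ with ∈-++⁻ (map (true ∷_) (interleavings a (suc b))) t∈
... | inj₂ t∈ʳ with _ , t∈′ , refl ← ∈-map⁻ (false ∷_) t∈ʳ = t∈′
... | inj₁ t∈ˡ with _ , _ , () ← ∈-map⁻ (true ∷_) t∈ˡ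

true∷∉-zero : ∀ {b t} → true ∷ t ∈ interleavings 0 b → ⊥
true∷∉-zero {zero}  (here ())
true∷∉-zero {suc b} (here ())

false∷∉-zero : ∀ {a t} → false ∷ t ∈ interleavings a 0 → ⊥
false∷∉-zero {zero}  (here ())
false∷∉-zero {suc a} (here ())

interleaving : ∀ a b → ∃[ w ] w ∈ interleavings a b
interleaving zero    b       = _ , here refl
interleaving (suc a) zero    = _ , here refl
interleaving (suc a) (suc b) = _ , true∷∈⁺ {a} {suc b} (proj₂ (interleaving a (suc b)))

interleaving-nonempty : ∀ {a b w} → w ∈ interleavings a b → 1 ≤ a + b → w ≢ []
interleaving-nonempty {zero}  {suc b} (here ()) _ refl
interleaving-nonempty {suc a} {zero}  (here ()) _ refl
interleaving-nonempty {suc a} {suc b} w∈ _ refl with ∈-++⁻ (map (true ∷_) (interleavings a (suc b))) w∈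
... | inj₁ w∈ˡ with _ , _ , () ← ∈-map⁻ (true ∷_) w∈ˡ
... | inj₂ w∈ʳ with _ , _ , () ← ∈-map⁻ (false ∷_) w∈ʳ

data _≼_ : Con → Con → Set where
  ≼-refl : ∀ {c} → c ≼ c
  ≼-none : ∀ {c} → c ≼ none

leftOK-≼ : ∀ {l l′ m n w} → l ≼ l′ → T (leftOK l m n w) → T (leftOK l′ m n w)
leftOK-≼ ≼-refl ok = ok
leftOK-≼ ≼-none _  = _

rightOK-≼ : ∀ {r r′ m n w} → r ≼ r′ → T (rightOK r m n w) → T (rightOK r′ m n w)
rightOK-≼ ≼-refl ok = ok
rightOK-≼ ≼-none _  = _

sat-≼ : ∀ {l l′ r r′ m n w} → l ≼ l′ → r ≼ r′ → T (sat l r m n w) → T (sat l′ r′ m n w)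
sat-≼ l≼ r≼ ok = let okˡ , okʳ = to T-∧ ok in from T-∧ (leftOK-≼ l≼ okˡ , rightOK-≼ r≼ okʳ)

sat-lt-tail : ∀ ρ r s w → w ≢ [] → T (sat lt ρ (suc r) s (true ∷ w)) → T (sat none ρ r s w)
sat-lt-tail ρ    r       s []      w≢[] _  = ⊥-elim (w≢[] refl)
sat-lt-tail none r       s (x ∷ w) _    _  = _
sat-lt-tail lt   zero    s (x ∷ w) _    _  = _
sat-lt-tail gt   zero    s (x ∷ w) _    _  = _
sat-lt-tail lt   (suc r) s (x ∷ w) _    ok = proj₂ (to T-∧ ok)
sat-lt-tail gt   (suc r) s (x ∷ w) _    ok = proj₂ (to T-∧ ok)

sat-gt-tail : ∀ ρ r s w → w ≢ [] → T (sat gt ρ r (suc s) (false ∷ w)) → T (sat none ρ r s w)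
sat-gt-tail ρ    r       s       []      w≢[] _  = ⊥-elim (w≢[] refl)
sat-gt-tail none r       s       (x ∷ w) _    _  = _
sat-gt-tail lt   zero    zero    (x ∷ w) _    _  = _
sat-gt-tail gt   zero    zero    (x ∷ w) _    _  = _
sat-gt-tail lt   (suc r) zero    (x ∷ w) _    _  = _
sat-gt-tail gt   (suc r) zero    (x ∷ w) _    _  = _
sat-gt-tail lt   r       (suc s) (x ∷ w) _    ok = proj₂ (to T-∧ ok)
sat-gt-tail gt   r       (suc s) (x ∷ w) _    ok = proj₂ (to T-∧ ok)

lt-head : ∀ ρ r s a b {u v} → u ∈ interleavings a b → 1 ≤ a + b →
          T (sat lt ρ (suc r) (suc s) (u ++ v)) → ∃[ t ] u ≡ true ∷ t
lt-head _ _ _ a b {[]}       u∈ pos _ = ⊥-elim (interleaving-nonempty {a} {b} u∈ pos refl)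
lt-head _ _ _ a b {true ∷ t} _  _   _ = t , refl

gt-head : ∀ ρ r s a b {u v} → u ∈ interleavings a b → 1 ≤ a + b →
          T (sat gt ρ (suc r) (suc s) (u ++ v)) → ∃[ t ] u ≡ false ∷ t
gt-head _ _ _ a b {[]}        u∈ pos _ = ⊥-elim (interleaving-nonempty {a} {b} u∈ pos refl)
gt-head _ _ _ a b {false ∷ t} _  _   _ = t , refl

count : (List Bool → Bool) → List (List Bool) → ℕ
count P = foldr (λ w c → if P w then suc c else c) 0

count-mono : ∀ {P Q} ws → (∀ {w} → w ∈ ws → T (P w) → T (Q w)) → count P ws ≤ count Q ws
count-mono             []       P⇒Q = z≤n
count-mono {P} {Q} (w ∷ ws) P⇒Q with P w in Pw | Q w in Qw
... | true  | true  = s≤s (count-mono ws (P⇒Q ∘ there))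
... | false | true  = m≤n⇒m≤1+n (count-mono ws (P⇒Q ∘ there))
... | false | false = count-mono ws (P⇒Q ∘ there)
... | true  | false with () ← subst T Qw (P⇒Q (here refl) (subst T (sym Pw) _))

count-++ : ∀ P ws vs → count P (ws ++ vs) ≡ count P ws + count P vs
count-++ P []       vs = refl
count-++ P (w ∷ ws) vs with P w
... | true  = cong suc (count-++ P ws vs)
... | false = count-++ P ws vs

count-map : ∀ P f ws → count P (map f ws) ≡ count (P ∘ f) ws
count-map P f []       = refl
count-map P f (w ∷ ws) with P (f w)
... | true  = cong suc (count-map P f ws)
... | false = count-map P f ws

count-false : ∀ ws → count (λ _ → false) ws ≡ 0
count-false []       = refl
count-false (w ∷ ws) = count-false ws

count-singleton : ∀ P w → count P (w ∷ []) ≤ 1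
count-singleton P w with P w
... | true  = s≤s z≤n
... | false = z≤n

count-∈ : ∀ {P w ws} → w ∈ ws → T (P w) → 1 ≤ count P ws
count-∈ {P} {ws = v ∷ ws} w∈ ok with P v in Pv
... | true = s≤s z≤n
count-∈ (here refl) ok | false with () ← subst T Pv ok
count-∈ (there w∈)  ok | false = count-∈ w∈ ok

countSat-≼ : ∀ {l l′ r r′} m n → l ≼ l′ → r ≼ r′ → countSat l r m n ≤ countSat l′ r′ m n
countSat-≼ m n l≼ r≼ = count-mono (interleavings m n) (λ _ → sat-≼ l≼ r≼)

countSat-emptyˡ : ∀ {l r} n → countSat l r 0 n ≤ 1
countSat-emptyˡ {l} {r} n = count-singleton (sat l r 0 n) (replicate n false)

countSat-emptyʳ : ∀ {l r} m → countSat l r m 0 ≤ 1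
countSat-emptyʳ {l} {r} zero    = count-singleton (sat l r 0 0) []
countSat-emptyʳ {l} {r} (suc m) = count-singleton (sat l r (suc m) 0) (replicate (suc m) true)

countSat-none : ∀ a b → 2 ≤ countSat none none (suc a) (suc b)
countSat-none a b = begin
  2
    ≤⟨ +-mono-≤ (count-∈ (∈-map⁺ (true ∷_) u∈) _) (count-∈ (∈-map⁺ (false ∷_) v∈) _) ⟩
  count P (map (true ∷_) U) + count P (map (false ∷_) V)
    ≡⟨ count-++ P (map (true ∷_) U) _ ⟨
  countSat none none (suc a) (suc b) ∎
  where
  open ≤-Reasoning
  P : List Bool → Bool
  P = sat none none (suc a) (suc b)
  U V : List (List Bool)
  U = interleavings a (suc b)
  V = interleavings (suc a) b
  u∈ : proj₁ (interleaving a (suc b)) ∈ U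
  u∈ = proj₂ (interleaving a (suc b))
  v∈ : proj₁ (interleaving (suc a) b) ∈ V
  v∈ = proj₂ (interleaving (suc a) b)

-- In both lemmas below, P vanishes definitionally on the words that violate the left constraint.
countSat-lt : ∀ ρ r s → countSat lt ρ (suc r) (suc s) ≤ countSat none ρ r (suc s)
countSat-lt ρ r s = begin
  count P (map (true ∷_) U ++ map (false ∷_) V)
    ≡⟨ count-++ P (map (true ∷_) U) _ ⟩
  count P (map (true ∷_) U) + count P (map (false ∷_) V)
    ≡⟨ cong₂ _+_ (count-map P _ U) (trans (count-map P _ V) (count-false V)) ⟩
  count (P ∘ (true ∷_)) U + 0
    ≡⟨ +-identityʳ _ ⟩
  count (P ∘ (true ∷_)) U
    ≤⟨ count-mono U (λ {w} w∈ → sat-lt-tail ρ r (suc s) w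
                                  (interleaving-nonempty {r} {suc s} w∈ (1≤m+1+n r s))) ⟩
  countSat none ρ r (suc s) ∎
  where
  open ≤-Reasoning
  P : List Bool → Bool
  P = sat lt ρ (suc r) (suc s)
  U V : List (List Bool)
  U = interleavings r (suc s)
  V = interleavings (suc r) s

countSat-gt : ∀ ρ r s → countSat gt ρ (suc r) (suc s) ≤ countSat none ρ (suc r) s
countSat-gt ρ r s = begin
  count P (map (true ∷_) U ++ map (false ∷_) V)
    ≡⟨ count-++ P (map (true ∷_) U) _ ⟩
  count P (map (true ∷_) U) + count P (map (false ∷_) V)
    ≡⟨ cong₂ _+_ (trans (count-map P _ U) (count-false U)) (count-map P _ V) ⟩
  count (P ∘ (false ∷_)) V
    ≤⟨ count-mono V (λ {w} w∈ → sat-gt-tail ρ (suc r) s w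
                                  (interleaving-nonempty {suc r} {s} w∈ (s≤s z≤n))) ⟩
  countSat none ρ (suc r) s ∎
  where
  open ≤-Reasoning
  P : List Bool → Bool
  P = sat gt ρ (suc r) (suc s)
  U V : List (List Bool)
  U = interleavings r (suc s)
  V = interleavings (suc r) s

-- Splittings

-- a_i and b_j lie on different sides of splitting (S) at (p, q), (A) sharing a_k, or (B) sharing b_k.
SeparatedS SeparatedA SeparatedB : ℕ → ℕ → ℕ → ℕ → Set
SeparatedS i j p q = (i ≤ p × q < j) ⊎ (p < i × j ≤ q)
SeparatedA i j k q = (i < k × q < j) ⊎ (k < i × j ≤ q)
SeparatedB i j p k = (i ≤ p × k < j) ⊎ (p < i × j < k)

T-≤ᵇ : ∀ {m n} → T (m ≤ᵇ n) ⇔ m ≤ n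
T-≤ᵇ = mk⇔ (≤ᵇ⇒≤ _ _) ≤⇒≤ᵇ

T-<ᵇ : ∀ {m n} → T (m <ᵇ n) ⇔ m < n
T-<ᵇ = mk⇔ (<ᵇ⇒< _ _) <⇒<ᵇ

T-separatedS : ∀ {i j p q} →
               T (((i ≤ᵇ p) ∧ (q <ᵇ j)) ∨ ((p <ᵇ i) ∧ (j ≤ᵇ q))) ⇔ SeparatedS i j p q
T-separatedS = ⇔-trans T-∨ (⇔-trans T-∧ (T-≤ᵇ ×-⇔ T-<ᵇ) ⊎-⇔ ⇔-trans T-∧ (T-<ᵇ ×-⇔ T-≤ᵇ))

T-separatedA : ∀ {i j k q} →
               T (((i <ᵇ k) ∧ (q <ᵇ j)) ∨ ((k <ᵇ i) ∧ (j ≤ᵇ q))) ⇔ SeparatedA i j k q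
T-separatedA = ⇔-trans T-∨ (⇔-trans T-∧ (T-<ᵇ ×-⇔ T-<ᵇ) ⊎-⇔ ⇔-trans T-∧ (T-<ᵇ ×-⇔ T-≤ᵇ))

T-separatedB : ∀ {i j p k} →
               T (((i ≤ᵇ p) ∧ (k <ᵇ j)) ∨ ((p <ᵇ i) ∧ (j <ᵇ k))) ⇔ SeparatedB i j p k
T-separatedB = ⇔-trans T-∨ (⇔-trans T-∧ (T-≤ᵇ ×-⇔ T-<ᵇ) ⊎-⇔ ⇔-trans T-∧ (T-<ᵇ ×-⇔ T-<ᵇ))

separatedA⇒S : ∀ {i j k q} → SeparatedA i j k q → SeparatedS i j k q
separatedA⇒S = ⊎-map (map₁ <⇒≤) id

separatedB⇒S : ∀ {i j p l} → SeparatedB i j p l → SeparatedS i j p l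
separatedB⇒S = ⊎-map id (map₂ <⇒≤)

separatedS-shift : ∀ {i j p q} → SeparatedS i j p q → SeparatedS (suc i) (suc j) (suc p) (suc q)
separatedS-shift = ⊎-map (×-map s≤s s≤s) (×-map s≤s s≤s)

separatedS⇒positive : ∀ {i j p q} → 1 ≤ i → 1 ≤ j → SeparatedS i j p q → 1 ≤ p + q
separatedS⇒positive {p = p} {q} 1≤i _   (inj₁ (i≤p , _)) = ≤-trans (≤-trans 1≤i i≤p) (m≤m+n p q)
separatedS⇒positive {p = p} {q} _   1≤j (inj₂ (_ , j≤q)) = ≤-trans (≤-trans 1≤j j≤q) (m≤n+m q p)

separatedS⇒upper-positive : ∀ {m n i j p q} → i ∈[1, m ] → j ∈[1, n ] → SeparatedS i j p q →
                            1 ≤ (m ∸ p) + (n ∸ q)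
separatedS⇒upper-positive {m} {n} {p = p} {q} _        (_ , j≤n) (inj₁ (_ , q<j)) =
  ≤-trans (m<n⇒0<n∸m (≤-trans q<j j≤n)) (m≤n+m (n ∸ q) (m ∸ p))
separatedS⇒upper-positive {m} {n} {p = p} {q} (_ , i≤m) _        (inj₂ (p<i , _)) =
  ≤-trans (m<n⇒0<n∸m (≤-trans p<i i≤m)) (m≤m+n (m ∸ p) (n ∸ q))

withShared : Bool → List Bool → List Bool → List Bool
withShared x u v = u ++ x ∷ v

data Admissible (l r : Con) (m n : ℕ) (glue : List Bool → List Bool → List Bool) (p q p′ q′ : ℕ)
                : Set where
  admissible : ∀ {u v} → u ∈ interleavings p q → v ∈ interleavings p′ q′ →
               T (sat l r m n (glue u v)) → Admissible l r m n glue p q p′ q′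

T-admissibleWord : ∀ {l r m n glue p q p′ q′} →
                   T (admissibleWord l r m n glue p q p′ q′) ⇔ Admissible l r m n glue p q p′ q′
T-admissibleWord = mk⇔
  (λ adm → let _ , u∈ , adm′ = find (any⁻ _ _ adm)
               _ , v∈ , ok   = find (any⁻ _ _ adm′)
           in  admissible u∈ v∈ ok)
  (λ { (admissible u∈ v∈ ok) → any⁺ _ (lose u∈ (any⁺ _ (lose v∈ ok))) })

admissible-none : ∀ {m n glue p q p′ q′} → Admissible none none m n glue p q p′ q′
admissible-none {p = p} {q} {p′} {q′} =
  admissible (proj₂ (interleaving p q)) (proj₂ (interleaving p′ q′)) _

Admissible-≼ : ∀ {l l′ r r′ m n glue p q p′ q′} → l ≼ l′ → r ≼ r′ →
               Admissible l r m n glue p q p′ q′ → Admissible l′ r′ m n glue p q p′ q′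
Admissible-≼ l≼ r≼ (admissible u∈ v∈ ok) = admissible u∈ v∈ (sat-≼ l≼ r≼ ok)

Valuation : Set
Valuation = Con → Con → ℕ → ℕ → ℕ

data Splitting (V : Valuation) (l r : Con) (m n i j : ℕ) : ℕ → Set where
  split-S : ∀ p q → p ≤ m → q ≤ n → SeparatedS i j p q →
            Admissible l r m n _++_ p q (m ∸ p) (n ∸ q) →
            Splitting V l r m n i j (V l none p q + V none r (m ∸ p) (n ∸ q))
  split-A : ∀ k q → k ∈[1, m ] → 1 ≤ q → q < n → SeparatedA i j k q →
            Admissible l r m n (withShared true) (k ∸ 1) q (m ∸ k) (n ∸ q) →
            Splitting V l r m n i j (V l gt k q + V lt r (suc (m ∸ k)) (n ∸ q))
  split-B : ∀ p k → 1 ≤ p → p < m → k ∈[1, n ] → SeparatedB i j p k →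
            Admissible l r m n (withShared false) p (k ∸ 1) (m ∸ p) (n ∸ k) →
            Splitting V l r m n i j (V l lt p k + V gt r (m ∸ p) (suc (n ∸ k)))

split-S-sizes : ∀ {m n i j p q} → i ∈[1, m ] → j ∈[1, n ] → p ≤ m → q ≤ n → SeparatedS i j p q →
                p + q < m + n × (m ∸ p) + (n ∸ q) < m + n
split-S-sizes {n = n} {q = q} (1≤i , _) (_ , j≤n) p≤m q≤n (inj₁ (i≤p , q<j)) =
  +-mono-≤-< p≤m (≤-trans q<j j≤n) ,
  +-mono-<-≤ (∸-monoʳ-< (≤-trans 1≤i i≤p) p≤m) (m∸n≤m n q)
split-S-sizes {m = m} {p = p} (_ , i≤m) (1≤j , _) p≤m q≤n (inj₂ (p<i , j≤q)) =
  +-mono-<-≤ (≤-trans p<i i≤m) q≤n ,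
  +-mono-≤-< (m∸n≤m m p) (∸-monoʳ-< (≤-trans 1≤j j≤q) q≤n)

split-A-sizes : ∀ {m n k q} → k ∈[1, m ] → 1 ≤ q → q < n →
                k + q < m + n × suc (m ∸ k) + (n ∸ q) < m + n
split-A-sizes (1≤k , k≤m) 1≤q q<n =
  +-mono-≤-< k≤m q<n , +-mono-≤-< (∸-monoʳ-< 1≤k k≤m) (∸-monoʳ-< 1≤q (<⇒≤ q<n))

split-B-sizes : ∀ {m n p k} → 1 ≤ p → p < m → k ∈[1, n ] →
                p + k < m + n × (m ∸ p) + suc (n ∸ k) < m + n
split-B-sizes 1≤p p<m (1≤k , k≤n) =
  +-mono-<-≤ p<m k≤n , +-mono-<-≤ (∸-monoʳ-< 1≤p (<⇒≤ p<m)) (∸-monoʳ-< 1≤k k≤n)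

Splitting-≼ : ∀ {V W l l′ r r′ m n i j x} →
              (∀ {l₀ l₀′ r₀ r₀′ p q} → p + q < m + n → l₀ ≼ l₀′ → r₀ ≼ r₀′ →
                 V l₀ r₀ p q ≤ W l₀′ r₀′ p q) →
              l ≼ l′ → r ≼ r′ → i ∈[1, m ] → j ∈[1, n ] →
              Splitting V l r m n i j x → ∃[ y ] Splitting W l′ r′ m n i j y × x ≤ y
Splitting-≼ V≤W l≼ r≼ i∈ j∈ (split-S p q p≤m q≤n sep adm) =
  let s₁ , s₂ = split-S-sizes i∈ j∈ p≤m q≤n sep in
  _ , split-S p q p≤m q≤n sep (Admissible-≼ l≼ r≼ adm) ,
  +-mono-≤ (V≤W s₁ l≼ ≼-refl) (V≤W s₂ ≼-refl r≼)
Splitting-≼ V≤W l≼ r≼ _ _ (split-A k q k∈ 1≤q q<n sep adm) =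
  let s₁ , s₂ = split-A-sizes k∈ 1≤q q<n in
  _ , split-A k q k∈ 1≤q q<n sep (Admissible-≼ l≼ r≼ adm) ,
  +-mono-≤ (V≤W s₁ l≼ ≼-refl) (V≤W s₂ ≼-refl r≼)
Splitting-≼ V≤W l≼ r≼ _ _ (split-B p k 1≤p p<m k∈ sep adm) =
  let s₁ , s₂ = split-B-sizes 1≤p p<m k∈ in
  _ , split-B p k 1≤p p<m k∈ sep (Admissible-≼ l≼ r≼ adm) ,
  +-mono-≤ (V≤W s₁ l≼ ≼-refl) (V≤W s₂ ≼-refl r≼)

Splitting-transfer : ∀ {V W l r m n i j x} →
                     (∀ {l₀ r₀ p q} → p + q < m + n → V l₀ r₀ p q ≡ W l₀ r₀ p q) →
                     i ∈[1, m ] → j ∈[1, n ] → Splitting V l r m n i j x → Splitting W l r m n i j x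
Splitting-transfer {W = W} {l} {r} {m} {n} {i} {j} V≡W i∈ j∈ (split-S p q p≤m q≤n sep adm) =
  let s₁ , s₂ = split-S-sizes i∈ j∈ p≤m q≤n sep in
  subst (Splitting W l r m n i j) (sym (cong₂ _+_ (V≡W s₁) (V≡W s₂)))
    (split-S p q p≤m q≤n sep adm)
Splitting-transfer {W = W} {l} {r} {m} {n} {i} {j} V≡W _ _ (split-A k q k∈ 1≤q q<n sep adm) =
  let s₁ , s₂ = split-A-sizes k∈ 1≤q q<n in
  subst (Splitting W l r m n i j) (sym (cong₂ _+_ (V≡W s₁) (V≡W s₂)))
    (split-A k q k∈ 1≤q q<n sep adm)
Splitting-transfer {W = W} {l} {r} {m} {n} {i} {j} V≡W _ _ (split-B p k 1≤p p<m k∈ sep adm) =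
  let s₁ , s₂ = split-B-sizes 1≤p p<m k∈ in
  subst (Splitting W l r m n i j) (sym (cong₂ _+_ (V≡W s₁) (V≡W s₂)))
    (split-B p k 1≤p p<m k∈ sep adm)

-- The candidate lists of the where-block of Mf, so that Mf (suc f) unfolds definitionally
-- to minList (comparisonCosts f …).
splitValueS splitValueA splitValueB : ℕ → Con → Con → ℕ → ℕ → ℕ → ℕ → ℕ → ℕ → List ℕ
splitValueS f l r m n i j p q =
  if (((i ≤ᵇ p) ∧ (q <ᵇ j)) ∨ ((p <ᵇ i) ∧ (j ≤ᵇ q)))
     ∧ admissibleWord l r m n _++_ p q (m ∸ p) (n ∸ q)
  then Mf f l none p q + Mf f none r (m ∸ p) (n ∸ q) ∷ [] else []
splitValueA f l r m n i j k q =
  if (((i <ᵇ k) ∧ (q <ᵇ j)) ∨ ((k <ᵇ i) ∧ (j ≤ᵇ q)))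
     ∧ admissibleWord l r m n (withShared true) (k ∸ 1) q (m ∸ k) (n ∸ q)
  then Mf f l gt k q + Mf f lt r (suc (m ∸ k)) (n ∸ q) ∷ [] else []
splitValueB f l r m n i j p k =
  if (((i ≤ᵇ p) ∧ (k <ᵇ j)) ∨ ((p <ᵇ i) ∧ (j <ᵇ k)))
     ∧ admissibleWord l r m n (withShared false) p (k ∸ 1) (m ∸ p) (n ∸ k)
  then Mf f l lt p k + Mf f gt r (m ∸ p) (suc (n ∸ k)) ∷ [] else []

splitValuesS splitValuesA splitValuesB splitValues : ℕ → Con → Con → ℕ → ℕ → ℕ → ℕ → List ℕ
splitValuesS f l r m n i j =
  concatMap (λ p → concatMap (splitValueS f l r m n i j p) (from0 n)) (from0 m)
splitValuesA f l r m n i j =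
  concatMap (λ k → concatMap (splitValueA f l r m n i j k) (from1 (n ∸ 1))) (from1 m)
splitValuesB f l r m n i j =
  concatMap (λ p → concatMap (splitValueB f l r m n i j p) (from1 n)) (from1 (m ∸ 1))
splitValues f l r m n i j =
  splitValuesS f l r m n i j ++ splitValuesA f l r m n i j ++ splitValuesB f l r m n i j

comparisonCost : ℕ → Con → Con → ℕ → ℕ → ℕ → ℕ → ℕ
comparisonCost f l r m n i j = suc (maxList (splitValues f l r m n i j))

comparisonCosts : ℕ → Con → Con → ℕ → ℕ → List ℕ
comparisonCosts f l r m n =
  concatMap (λ i → map (comparisonCost f l r m n i) (from1 n)) (from1 m)

∈-splitValuesS⁻ : ∀ {f l r m n i j x} → x ∈ splitValuesS f l r m n i j →
                  Splitting (Mf f) l r m n i j x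
∈-splitValuesS⁻ {f} {l} {r} {m} {n} {i} {j} x∈
  with p , q , p∈ , q∈ , x∈′
         ← ∈-concatMap²⁻ {f = splitValueS f l r m n i j} {as = from0 m} {bs = from0 n} x∈
  with ok , refl ← ∈-if⁻ x∈′ =
  let sep , adm = to T-∧ ok in
  split-S p q (∈-from0⁻ p∈) (∈-from0⁻ q∈) (to T-separatedS sep) (to T-admissibleWord adm)

∈-splitValuesA⁻ : ∀ {f l r m n i j x} → x ∈ splitValuesA f l r m n i j →
                  Splitting (Mf f) l r m n i j x
∈-splitValuesA⁻ {f} {l} {r} {m} {n} {i} {j} x∈
  with k , q , k∈ , q∈ , x∈′
         ← ∈-concatMap²⁻ {f = splitValueA f l r m n i j} {as = from1 m} {bs = from1 (n ∸ 1)} x∈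
  with ok , refl ← ∈-if⁻ x∈′ =
  let sep , adm = to T-∧ ok ; 1≤q , q<n = ∈-from1-∸1⁻ q∈ in
  split-A k q (∈-from1⁻ k∈) 1≤q q<n (to T-separatedA sep) (to T-admissibleWord adm)

∈-splitValuesB⁻ : ∀ {f l r m n i j x} → x ∈ splitValuesB f l r m n i j →
                  Splitting (Mf f) l r m n i j x
∈-splitValuesB⁻ {f} {l} {r} {m} {n} {i} {j} x∈
  with p , k , p∈ , k∈ , x∈′
         ← ∈-concatMap²⁻ {f = splitValueB f l r m n i j} {as = from1 (m ∸ 1)} {bs = from1 n} x∈
  with ok , refl ← ∈-if⁻ x∈′ =
  let sep , adm = to T-∧ ok ; 1≤p , p<m = ∈-from1-∸1⁻ p∈ in
  split-B p k 1≤p p<m (∈-from1⁻ k∈) (to T-separatedB sep) (to T-admissibleWord adm)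

∈-splitValues⁻ : ∀ {f l r m n i j x} → x ∈ splitValues f l r m n i j →
                 Splitting (Mf f) l r m n i j x
∈-splitValues⁻ {f} {l} {r} {m} {n} {i} {j} x∈ with ∈-++⁻ (splitValuesS f l r m n i j) x∈
... | inj₁ x∈S = ∈-splitValuesS⁻ {f} x∈S
... | inj₂ x∈AB with ∈-++⁻ (splitValuesA f l r m n i j) x∈AB
...   | inj₁ x∈A = ∈-splitValuesA⁻ {f} x∈A
...   | inj₂ x∈B = ∈-splitValuesB⁻ {f} x∈B

∈-splitValues⁺ : ∀ {f l r m n i j x} → Splitting (Mf f) l r m n i j x →
                 x ∈ splitValues f l r m n i j
∈-splitValues⁺ {f} {l} {r} {m} {n} {i} {j} (split-S p q p≤m q≤n sep adm) =
  ∈-++⁺ˡ {ys = splitValuesA f l r m n i j ++ splitValuesB f l r m n i j}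
    (∈-concatMap²⁺ {f = splitValueS f l r m n i j} {as = from0 m} {bs = from0 n}
      (∈-from0⁺ p≤m) (∈-from0⁺ q≤n)
      (∈-if⁺ (from T-∧ (from (T-separatedS {i} {j} {p} {q}) sep , from T-admissibleWord adm))))
∈-splitValues⁺ {f} {l} {r} {m} {n} {i} {j} (split-A k q k∈ 1≤q q<n sep adm) =
  ∈-++⁺ʳ (splitValuesS f l r m n i j) (∈-++⁺ˡ {ys = splitValuesB f l r m n i j}
    (∈-concatMap²⁺ {f = splitValueA f l r m n i j} {as = from1 m} {bs = from1 (n ∸ 1)}
      (∈-from1⁺ k∈) (∈-from1-∸1⁺ 1≤q q<n)
      (∈-if⁺ (from T-∧ (from (T-separatedA {i} {j} {k} {q}) sep , from T-admissibleWord adm)))))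
∈-splitValues⁺ {f} {l} {r} {m} {n} {i} {j} (split-B p k 1≤p p<m k∈ sep adm) =
  ∈-++⁺ʳ (splitValuesS f l r m n i j) (∈-++⁺ʳ (splitValuesA f l r m n i j)
    (∈-concatMap²⁺ {f = splitValueB f l r m n i j} {as = from1 (m ∸ 1)} {bs = from1 n}
      (∈-from1-∸1⁺ 1≤p p<m) (∈-from1⁺ k∈)
      (∈-if⁺ (from T-∧ (from (T-separatedB {i} {j} {p} {k}) sep , from T-admissibleWord adm)))))

∈-comparisonCosts⁻ : ∀ {f l r m n c} → c ∈ comparisonCosts f l r m n →
                     ∃₂ λ i j → i ∈[1, m ] × j ∈[1, n ] × c ≡ comparisonCost f l r m n i j
∈-comparisonCosts⁻ {f} {l} {r} {m} {n} c∈ =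
  let i , i∈ , c∈′ = find (∈-concatMap⁻ (λ i → map (comparisonCost f l r m n i) (from1 n))
                                         {xs = from1 m} c∈)
      j , j∈ , c≡ = ∈-map⁻ (comparisonCost f l r m n i) c∈′
  in i , j , ∈-from1⁻ i∈ , ∈-from1⁻ j∈ , c≡

∈-comparisonCosts⁺ : ∀ {f l r m n i j} → i ∈[1, m ] → j ∈[1, n ] →
                     comparisonCost f l r m n i j ∈ comparisonCosts f l r m n
∈-comparisonCosts⁺ {f} {l} {r} {m} {n} {i} i∈ j∈ =
  ∈-concatMap⁺ (λ i → map (comparisonCost f l r m n i) (from1 n))
    (lose (∈-from1⁺ i∈) (∈-map⁺ (comparisonCost f l r m n i) (∈-from1⁺ j∈)))

≤ᵇ1≡false : ∀ {c} → 2 ≤ c → (c ≤ᵇ 1) ≡ false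
≤ᵇ1≡false (s≤s (s≤s _)) = refl

determined? : ∀ l r m n → countSat l r m n ≤ 1 ⊎ 2 ≤ countSat l r m n
determined? l r m n = ≤-<-connex (countSat l r m n) 1

Mf-determined : ∀ f {l r m n} → countSat l r m n ≤ 1 → Mf f l r m n ≡ 0
Mf-determined zero    _   = refl
Mf-determined (suc f) c≤1 rewrite to T-≡ (≤⇒≤ᵇ c≤1) = refl

Mf-undetermined : ∀ f {l r m n} → 2 ≤ countSat l r m n →
                  Mf (suc f) l r m n ≡ minList (comparisonCosts f l r m n)
Mf-undetermined f 2≤c rewrite ≤ᵇ1≡false 2≤c = refl

Mf-emptyˡ : ∀ f {l r} n → Mf f l r 0 n ≡ 0
Mf-emptyˡ f {l} {r} n = Mf-determined f (countSat-emptyˡ {l} {r} n)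

Mf-emptyʳ : ∀ f {l r} m → Mf f l r m 0 ≡ 0
Mf-emptyʳ f {l} {r} m = Mf-determined f (countSat-emptyʳ {l} {r} m)

undetermined⇒nonempty : ∀ {l r} m n → 2 ≤ countSat l r m n → 1 ≤ m × 1 ≤ n
undetermined⇒nonempty {l} {r} zero    n       2≤c =
  ⊥-elim (<⇒≱ 2≤c (countSat-emptyˡ {l} {r} n))
undetermined⇒nonempty {l} {r} (suc m) zero    2≤c =
  ⊥-elim (<⇒≱ 2≤c (countSat-emptyʳ {l} {r} (suc m)))
undetermined⇒nonempty         (suc m) (suc n) _   =
  s≤s z≤n , s≤s z≤n

Mf≤cost : ∀ f {l r m n i j} → i ∈[1, m ] → j ∈[1, n ] →
          Mf (suc f) l r m n ≤ comparisonCost f l r m n i j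
Mf≤cost f {l} {r} {m} {n} i∈ j∈ with determined? l r m n
... | inj₁ det = ≤-trans (≤-reflexive (Mf-determined (suc f) {l} {r} {m} {n} det)) z≤n
... | inj₂ und = ≤-trans (≤-reflexive (Mf-undetermined f {l} {r} {m} {n} und))
                         (minList-≤ (∈-comparisonCosts⁺ {f} {l} {r} i∈ j∈))

Mf-attained : ∀ f {l r m n} → 2 ≤ countSat l r m n →
              ∃₂ λ i j → i ∈[1, m ] × j ∈[1, n ] × Mf (suc f) l r m n ≡ comparisonCost f l r m n i j
Mf-attained f {l} {r} {m} {n} und =
  let 1≤m , 1≤n = undetermined⇒nonempty {l} {r} m n und
      some-cost∈ = ∈-comparisonCosts⁺ {f} {l} {r} (≤-refl , 1≤m) (≤-refl , 1≤n)
      i , j , i∈ , j∈ , eq = ∈-comparisonCosts⁻ {f} {l} {r} {m} {n} (minList-∈ some-cost∈)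
  in i , j , i∈ , j∈ , trans (Mf-undetermined f {l} {r} {m} {n} und) eq

Mf-≥ : ∀ f {l r m n K} → 2 ≤ countSat l r m n →
       (∀ {i j} → i ∈[1, m ] → j ∈[1, n ] → K ≤ comparisonCost f l r m n i j) →
       K ≤ Mf (suc f) l r m n
Mf-≥ f {l} {r} {m} {n} {K} und h =
  let _ , _ , i∈ , j∈ , eq = Mf-attained f {l} {r} {m} {n} und in subst (K ≤_) (sym eq) (h i∈ j∈)

cost-≤ : ∀ {f l r m n i j K} → (∀ {x} → Splitting (Mf f) l r m n i j x → x ≤ K) →
         comparisonCost f l r m n i j ≤ suc K
cost-≤ {f} {l} {r} {m} {n} {i} {j} bound =
  s≤s (maxList-≤ _ (bound ∘ ∈-splitValues⁻ {f} {l} {r} {m} {n} {i} {j}))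

<-cost : ∀ {f l r m n i j x} → Splitting (Mf f) l r m n i j x → x < comparisonCost f l r m n i j
<-cost {f} s = s≤s (≤-maxList (∈-splitValues⁺ {f} s))

cost-attained : ∀ {f l r m n i j x₀} → Splitting (Mf f) l r m n i j x₀ →
                ∃[ x ] Splitting (Mf f) l r m n i j x × comparisonCost f l r m n i j ≡ suc x
cost-attained {f} {l} {r} {m} {n} {i} {j} s =
  _ , ∈-splitValues⁻ {f} {l} {r} {m} {n} {i} {j} (maxList-∈ (∈-splitValues⁺ {f} s)) , refl

cost-mono : ∀ {f g l l′ r r′ m n i j} →
            (∀ {x} → Splitting (Mf f) l r m n i j x → ∃[ y ] Splitting (Mf g) l′ r′ m n i j y × x ≤ y) →
            comparisonCost f l r m n i j ≤ comparisonCost g l′ r′ m n i j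
cost-mono {f} {g} {l} {l′} {r} {r′} {m} {n} {i} {j} dominated =
  cost-≤ {f} {l} {r} {m} {n} {i} {j} λ s →
    let _ , s′ , x≤y = dominated s in ≤-trans x≤y (s≤s⁻¹ (<-cost {g} {l′} {r′} {m} {n} {i} {j} s′))

-- Monotonicity and fuel independence

Mf-mono : ∀ f g {l l′ r r′ m n} → l ≼ l′ → r ≼ r′ → m + n ≤ f → m + n ≤ g →
          Mf f l r m n ≤ Mf g l′ r′ m n
Mf-mono zero    g                                  _ _ _ _  = z≤n
Mf-mono (suc f) zero {l} {r = r} {m = zero}  {n} _ _ _ _  = ≤-reflexive (Mf-emptyˡ (suc f) {l} {r} n)
Mf-mono (suc f) zero             {m = suc m}     _ _ _ ()
Mf-mono (suc f) (suc g) {l} {l′} {r} {r′} {m} {n} l≼ r≼ m+n≤f m+n≤g =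
  [ (λ det → ≤-trans (≤-reflexive (Mf-determined (suc f) {l} {r} {m} {n} det)) z≤n)
  , (λ und → via (Mf-attained g {l′} {r′} {m} {n} (≤-trans und (countSat-≼ m n l≼ r≼))))
  ]′ (determined? l r m n)
  where
  open ≤-Reasoning
  ih : ∀ {l₀ l₀′ r₀ r₀′ p q} → p + q < m + n → l₀ ≼ l₀′ → r₀ ≼ r₀′ →
       Mf f l₀ r₀ p q ≤ Mf g l₀′ r₀′ p q
  ih p+q< l₀≼ r₀≼ = Mf-mono f g l₀≼ r₀≼ (m<n≤1+o⇒m≤o p+q< m+n≤f) (m<n≤1+o⇒m≤o p+q< m+n≤g)
  via : (∃₂ λ i j → i ∈[1, m ] × j ∈[1, n ] × Mf (suc g) l′ r′ m n ≡ comparisonCost g l′ r′ m n i j) →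
        Mf (suc f) l r m n ≤ Mf (suc g) l′ r′ m n
  via (i , j , i∈ , j∈ , eq) = begin
    Mf (suc f) l r m n             ≤⟨ Mf≤cost f i∈ j∈ ⟩
    comparisonCost f l r m n i j   ≤⟨ cost-mono {f} {g} (Splitting-≼ {Mf f} {Mf g} ih l≼ r≼ i∈ j∈) ⟩
    comparisonCost g l′ r′ m n i j ≡⟨ eq ⟨
    Mf (suc g) l′ r′ m n           ∎

Mf≡M : ∀ {f l r m n} → m + n ≤ f → Mf f l r m n ≡ M l r m n
Mf≡M {f} {m = m} {n} m+n≤f =
  ≤-antisym (Mf-mono f (m + n) ≼-refl ≼-refl m+n≤f ≤-refl)
            (Mf-mono (m + n) f ≼-refl ≼-refl ≤-refl m+n≤f)

M-unfold : ∀ {l r m n} → M l r m n ≡ Mf (suc (m + n)) l r m n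
M-unfold {l} {r} {m} {n} = sym (Mf≡M {suc (m + n)} {l} {r} {m} {n} (n≤1+n _))

M-mono : ∀ {l l′ r r′} m n → l ≼ l′ → r ≼ r′ → M l r m n ≤ M l′ r′ m n
M-mono m n l≼ r≼ = Mf-mono (m + n) (m + n) l≼ r≼ ≤-refl ≤-refl

M-determined : ∀ {l r m n} → countSat l r m n ≤ 1 → M l r m n ≡ 0
M-determined {l} {r} {m} {n} = Mf-determined (m + n) {l} {r} {m} {n}

M-emptyˡ : ∀ {l r} n → M l r 0 n ≡ 0
M-emptyˡ n = Mf-emptyˡ n n

M-emptyʳ : ∀ {l r} m → M l r m 0 ≡ 0
M-emptyʳ m = Mf-emptyʳ (m + 0) m

Splitting-Mf⇒M : ∀ {f l r m n i j x} → m + n ≤ suc f → i ∈[1, m ] → j ∈[1, n ] →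
                 Splitting (Mf f) l r m n i j x → Splitting M l r m n i j x
Splitting-Mf⇒M m+n≤ = Splitting-transfer (λ p+q< → Mf≡M (m<n≤1+o⇒m≤o p+q< m+n≤))

Splitting-M⇒Mf : ∀ {f l r m n i j x} → m + n ≤ suc f → i ∈[1, m ] → j ∈[1, n ] →
                 Splitting M l r m n i j x → Splitting (Mf f) l r m n i j x
Splitting-M⇒Mf m+n≤ = Splitting-transfer (λ p+q< → sym (Mf≡M (m<n≤1+o⇒m≤o p+q< m+n≤)))

M-≤ : ∀ {l r m n i j K} → i ∈[1, m ] → j ∈[1, n ] →
      (∀ {x} → Splitting M l r m n i j x → x ≤ K) → M l r m n ≤ suc K
M-≤ {l} {r} {m} {n} {i} {j} {K} i∈ j∈ bound = begin
  M l r m n                          ≡⟨ M-unfold {l} {r} {m} {n} ⟩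
  Mf (suc (m + n)) l r m n           ≤⟨ Mf≤cost (m + n) {l} {r} i∈ j∈ ⟩
  comparisonCost (m + n) l r m n i j ≤⟨ cost-≤ {m + n} (bound ∘ Splitting-Mf⇒M (n≤1+n _) i∈ j∈) ⟩
  suc K                              ∎
  where open ≤-Reasoning

record OptimalComparison (l r : Con) (m n : ℕ) : Set where
  field
    i j     : ℕ
    i∈      : i ∈[1, m ]
    j∈      : j ∈[1, n ]
    K       : ℕ
    M≡1+K   : M l r m n ≡ suc K
    bounded : ∀ {x} → Splitting M l r m n i j x → x ≤ K

M-attained : ∀ {l r m n} → 2 ≤ countSat l r m n → OptimalComparison l r m n
M-attained {l} {r} {m} {n} und =
  let i , j , i∈ , j∈ , eq = Mf-attained (m + n) {l} {r} {m} {n} und in record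
    { i∈ = i∈ ; j∈ = j∈ ; M≡1+K = trans (M-unfold {l} {r} {m} {n}) eq
    ; bounded = λ s → s≤s⁻¹ (<-cost {m + n} (Splitting-M⇒Mf (n≤1+n _) i∈ j∈ s)) }

M-≥ : ∀ {l r m n K} → 2 ≤ countSat l r m n →
      (∀ {i j} → i ∈[1, m ] → j ∈[1, n ] → ∃[ x ] Splitting M l r m n i j x × K ≤ x) →
      suc K ≤ M l r m n
M-≥ {l} {r} {m} {n} {K} und splitting =
  subst (suc K ≤_) (sym (M-unfold {l} {r} {m} {n})) (Mf-≥ (m + n) {l} {r} {m} {n} und bound)
  where
  bound : ∀ {i j} → i ∈[1, m ] → j ∈[1, n ] → suc K ≤ comparisonCost (m + n) l r m n i j
  bound i∈ j∈ = let _ , s , K≤x = splitting i∈ j∈ in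
    ≤-trans (s≤s K≤x) (<-cost {m + n} (Splitting-M⇒Mf (n≤1+n _) i∈ j∈ s))

M-≤-splitting : ∀ {l r m n i j x₀} → i ∈[1, m ] → j ∈[1, n ] → Splitting M l r m n i j x₀ →
                ∃[ x ] Splitting M l r m n i j x × M l r m n ≤ suc x
M-≤-splitting {l} {r} {m} {n} {i} {j} i∈ j∈ s₀ =
  let x , s , eq = cost-attained {m + n} (Splitting-M⇒Mf (n≤1+n _) i∈ j∈ s₀) in
  x , Splitting-Mf⇒M (n≤1+n _) i∈ j∈ s ,
  ≤-trans (≤-reflexive (M-unfold {l} {r} {m} {n}))
          (≤-trans (Mf≤cost (m + n) {l} {r} i∈ j∈) (≤-reflexive eq))

-- Dropping a known minimum

admissible-lt-empty : ∀ {ρ r s b p′ q′} (g : List Bool → List Bool) → 1 ≤ b →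
                      ¬ Admissible lt ρ (suc r) (suc s) (λ u v → u ++ g v) 0 b p′ q′
admissible-lt-empty {ρ} {r} {s} {b} _ 1≤b (admissible u∈ _ ok)
  with _ , refl ← lt-head ρ r s 0 b u∈ 1≤b ok = true∷∉-zero {b} u∈

admissible-gt-empty : ∀ {ρ r s a p′ q′} (g : List Bool → List Bool) → 1 ≤ a →
                      ¬ Admissible gt ρ (suc r) (suc s) (λ u v → u ++ g v) a 0 p′ q′
admissible-gt-empty {ρ} {r} {s} {a} _ 1≤a (admissible u∈ _ ok)
  with _ , refl ← gt-head ρ r s a 0 u∈ (≤-trans 1≤a (m≤m+n a 0)) ok = false∷∉-zero {a} u∈

admissible-drop-a₁ : ∀ {ρ r s a b p′ q′} (g : List Bool → List Bool) →
                     (∀ {t v} → t ∈ interleavings a b → t ++ g v ≢ []) →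
                     Admissible lt ρ (suc r) (suc s) (λ u v → u ++ g v) (suc a) b p′ q′ →
                     Admissible none ρ r (suc s) (λ u v → u ++ g v) a b p′ q′
admissible-drop-a₁ {ρ} {r} {s} {a} {b} g nonempty (admissible {v = v} u∈ v∈ ok)
  with t , refl ← lt-head ρ r s (suc a) b u∈ (s≤s z≤n) ok =
  let t∈ = true∷∈⁻ {a} {b} u∈ in admissible t∈ v∈ (sat-lt-tail ρ r (suc s) (t ++ g v) (nonempty t∈) ok)

admissible-drop-b₁ : ∀ {ρ r s a b p′ q′} (g : List Bool → List Bool) →
                     (∀ {t v} → t ∈ interleavings a b → t ++ g v ≢ []) →
                     Admissible gt ρ (suc r) (suc s) (λ u v → u ++ g v) a (suc b) p′ q′ →
                     Admissible none ρ (suc r) s (λ u v → u ++ g v) a b p′ q′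
admissible-drop-b₁ {ρ} {r} {s} {a} {b} g nonempty (admissible {v = v} u∈ v∈ ok)
  with t , refl ← gt-head ρ r s a (suc b) u∈ (1≤m+1+n a b) ok =
  let t∈ = false∷∈⁻ {a} {b} u∈ in admissible t∈ v∈ (sat-gt-tail ρ (suc r) s (t ++ g v) (nonempty t∈) ok)

drop-a₁-splitting : ∀ {ρ r s i j x} →
                    (∀ ρ′ p q → p + q < r + suc s → M lt ρ′ (suc p) q ≤ M none ρ′ p q) →
                    i ∈[1, r ] → j ∈[1, suc s ] → Splitting M lt ρ (suc r) (suc s) (suc i) j x →
                    ∃[ y ] Splitting M none ρ r (suc s) i j y × x ≤ y
drop-a₁-splitting _ _ (1≤j , _) (split-S zero q _ _ (inj₂ (_ , j≤q)) adm) =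
  ⊥-elim (admissible-lt-empty id (≤-trans 1≤j j≤q) adm)
drop-a₁-splitting {ρ} {r} {s} ih i∈ j∈ (split-S (suc p) q p<r q≤n sep adm) =
  _ , split-S p q (s≤s⁻¹ p<r) q≤n sep′ (admissible-drop-a₁ id nonempty adm) ,
  +-monoˡ-≤ (M none ρ (r ∸ p) (suc s ∸ q)) (ih none p q (proj₁ (split-S-sizes i∈ j∈ (s≤s⁻¹ p<r) q≤n sep′)))
  where
  sep′ : SeparatedS _ _ p q
  sep′ = ⊎-map (map₁ s≤s⁻¹) (map₁ s≤s⁻¹) sep
  nonempty : ∀ {t v} → t ∈ interleavings p q → t ++ v ≢ []
  nonempty {t} {v} t∈ =
    interleaving-nonempty {p} {q} t∈ (separatedS⇒positive (1≤ i∈) (1≤ j∈) sep′) ∘ ++-conicalˡ t v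
drop-a₁-splitting _ _ _ (split-A zero _ (() , _) _ _ _ _)
drop-a₁-splitting _ _ _ (split-A 1 q _ 1≤q _ _ adm) = ⊥-elim (admissible-lt-empty (true ∷_) 1≤q adm)
drop-a₁-splitting {ρ} {r} {s} ih _ _ (split-A (suc (suc k)) q (_ , k<r) 1≤q q<n sep adm) =
  _ , split-A (suc k) q k∈ 1≤q q<n (⊎-map (map₁ s≤s⁻¹) (map₁ s≤s⁻¹) sep)
        (admissible-drop-a₁ (true ∷_) (λ {t} {v} _ → ++∷≢[] t true v) adm) ,
  +-monoˡ-≤ (M lt ρ (suc (r ∸ suc k)) (suc s ∸ q)) (ih gt (suc k) q (proj₁ (split-A-sizes k∈ 1≤q q<n)))
  where
  k∈ : suc k ∈[1, r ]
  k∈ = s≤s z≤n , s≤s⁻¹ k<r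
drop-a₁-splitting _ _ _ (split-B zero _ () _ _ _ _)
drop-a₁-splitting _ _ _ (split-B 1 zero _ _ (() , _) _ _)
-- The lower part of this splitting contains a₁ only, so without a₁ it becomes a splitting (S).
drop-a₁-splitting {ρ} {r} {s} ih (1≤i , i≤r) _
                  (split-B 1 (suc k) _ _ (_ , k<n) sep (admissible {v = v} u∈ v∈ ok))
  with t , refl ← lt-head ρ r s 1 k u∈ (s≤s z≤n) ok =
  _ , split-S 0 k z≤n (m≤n⇒m≤1+n k≤s) sep′ adm′ , +-mono-≤ lower upper
  where
  k≤s : k ≤ s
  k≤s = s≤s⁻¹ k<n
  1+s∸k : suc s ∸ k ≡ suc (s ∸ k)
  1+s∸k = +-∸-assoc 1 k≤s
  sep′ : SeparatedS _ _ 0 k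
  sep′ = [ (λ { (s≤s i≤0 , _) → ⊥-elim (<⇒≱ 1≤i i≤0) }) , (λ (_ , j<k) → inj₂ (1≤i , s≤s⁻¹ j<k)) ]′ sep
  adm′ : Admissible none ρ r (suc s) _++_ 0 k r (suc s ∸ k)
  adm′ = admissible (true∷∈⁻ {0} {k} u∈)
                    (subst (λ n′ → false ∷ v ∈ interleavings r n′) (sym 1+s∸k) (false∷∈⁺ {r} {s ∸ k} v∈))
                    (sat-lt-tail ρ r (suc s) (t ++ false ∷ v) (++∷≢[] t false v) ok)
  lower : M lt lt 1 (suc k) ≤ M none none 0 k
  lower = ≤-trans (ih lt 0 (suc k) (≤-trans (s≤s k<n) (+-monoˡ-≤ (suc s) (≤-trans 1≤i i≤r))))
                  (≤-trans (≤-reflexive (M-emptyˡ {none} {lt} (suc k))) z≤n)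
  upper : M gt ρ r (suc (s ∸ k)) ≤ M none ρ r (suc s ∸ k)
  upper = subst (λ n′ → M gt ρ r (suc (s ∸ k)) ≤ M none ρ r n′) (sym 1+s∸k)
                (M-mono r (suc (s ∸ k)) ≼-none ≼-refl)
drop-a₁-splitting {ρ} {r} {s} ih _ _ (split-B (suc (suc p)) k _ p<m k∈ sep adm) =
  _ , split-B (suc p) k (s≤s z≤n) (s≤s⁻¹ p<m) k∈ (⊎-map (map₁ s≤s⁻¹) (map₁ s≤s⁻¹) sep)
        (admissible-drop-a₁ (false ∷_) (λ {t} {v} _ → ++∷≢[] t false v) adm) ,
  +-monoˡ-≤ (M gt ρ (r ∸ suc p) (suc (suc s ∸ k)))
            (ih lt (suc p) k (proj₁ (split-B-sizes (s≤s z≤n) (s≤s⁻¹ p<m) k∈)))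

-- Under a₁ < b₁ the element a₁ is the overall minimum; the comparison a_{i+1} : b_j then plays
-- the role of a_i : b_j in the problem without a₁.
M-lt≤M-none : ∀ ρ r s → M lt ρ (suc r) s ≤ M none ρ r s
M-lt≤M-none ρ r s = go ρ r s (<-wellFounded (r + s))
  where
  go : ∀ ρ r s → Acc _<_ (r + s) → M lt ρ (suc r) s ≤ M none ρ r s
  go ρ r zero    _         = ≤-trans (≤-reflexive (M-emptyʳ {lt} {ρ} (suc r))) z≤n
  go ρ r (suc s) (acc rec) =
    [ (λ det → ≤-trans (≤-reflexive (M-determined {lt} {ρ} {suc r} {suc s} det)) z≤n)
    , (λ und → via (M-attained {none} {ρ} {r} {suc s} (≤-trans und (countSat-lt ρ r s))))
    ]′ (determined? lt ρ (suc r) (suc s))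
    where
    ih : ∀ ρ′ p q → p + q < r + suc s → M lt ρ′ (suc p) q ≤ M none ρ′ p q
    ih ρ′ p q p+q< = go ρ′ p q (rec p+q<)
    via : OptimalComparison none ρ r (suc s) → M lt ρ (suc r) (suc s) ≤ M none ρ r (suc s)
    via opt = begin
      M lt ρ (suc r) (suc s) ≤⟨ M-≤ (s≤s z≤n , s≤s (≤m i∈)) j∈ bound ⟩
      suc K                  ≡⟨ M≡1+K ⟨
      M none ρ r (suc s)     ∎
      where
      open OptimalComparison opt
      open ≤-Reasoning
      bound : ∀ {x} → Splitting M lt ρ (suc r) (suc s) (suc i) j x → x ≤ K
      bound sp = let _ , sp′ , x≤y = drop-a₁-splitting ih i∈ j∈ sp in ≤-trans x≤y (bounded sp′)

drop-b₁-splitting : ∀ {ρ r s i j x} →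
                    (∀ ρ′ p q → p + q < suc r + s → M gt ρ′ p (suc q) ≤ M none ρ′ p q) →
                    i ∈[1, suc r ] → j ∈[1, s ] → Splitting M gt ρ (suc r) (suc s) i (suc j) x →
                    ∃[ y ] Splitting M none ρ (suc r) s i j y × x ≤ y
drop-b₁-splitting _ (1≤i , _) _ (split-S p zero _ _ (inj₁ (i≤p , _)) adm) =
  ⊥-elim (admissible-gt-empty id (≤-trans 1≤i i≤p) adm)
drop-b₁-splitting {ρ} {r} {s} ih i∈ j∈ (split-S p (suc q) p≤m q<n sep adm) =
  _ , split-S p q p≤m (s≤s⁻¹ q<n) sep′ (admissible-drop-b₁ id nonempty adm) ,
  +-monoˡ-≤ (M none ρ (suc r ∸ p) (s ∸ q)) (ih none p q (proj₁ (split-S-sizes i∈ j∈ p≤m (s≤s⁻¹ q<n) sep′)))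
  where
  sep′ : SeparatedS _ _ p q
  sep′ = ⊎-map (map₂ s≤s⁻¹) (map₂ s≤s⁻¹) sep
  nonempty : ∀ {t v} → t ∈ interleavings p q → t ++ v ≢ []
  nonempty {t} {v} t∈ =
    interleaving-nonempty {p} {q} t∈ (separatedS⇒positive (1≤ i∈) (1≤ j∈) sep′) ∘ ++-conicalˡ t v
drop-b₁-splitting _ _ _ (split-A _ zero _ () _ _ _)
drop-b₁-splitting _ _ _ (split-A zero 1 (() , _) _ _ _ _)
-- The lower part of this splitting contains b₁ only, so without b₁ it becomes a splitting (S).
drop-b₁-splitting {ρ} {r} {s} ih _ (1≤j , j≤s)
                  (split-A (suc k) 1 (_ , k<m) _ _ sep (admissible {v = v} u∈ v∈ ok))
  with t , refl ← gt-head ρ r s k 1 u∈ (1≤m+1+n k 0) ok =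
  _ , split-S k 0 (m≤n⇒m≤1+n k≤r) z≤n sep′ adm′ , +-mono-≤ lower upper
  where
  k≤r : k ≤ r
  k≤r = s≤s⁻¹ k<m
  1+r∸k : suc r ∸ k ≡ suc (r ∸ k)
  1+r∸k = +-∸-assoc 1 k≤r
  sep′ : SeparatedS _ _ k 0
  sep′ = [ (λ (i<k , _) → inj₁ (s≤s⁻¹ i<k , 1≤j)) , (λ { (_ , s≤s j≤0) → ⊥-elim (<⇒≱ 1≤j j≤0) }) ]′ sep
  adm′ : Admissible none ρ (suc r) s _++_ k 0 (suc r ∸ k) s
  adm′ = admissible (false∷∈⁻ {k} {0} u∈)
                    (subst (λ m′ → true ∷ v ∈ interleavings m′ s) (sym 1+r∸k) (true∷∈⁺ {r ∸ k} {s} v∈))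
                    (sat-gt-tail ρ (suc r) s (t ++ true ∷ v) (++∷≢[] t true v) ok)
  lower : M gt gt (suc k) 1 ≤ M none none k 0
  lower = ≤-trans (ih gt (suc k) 0 (≤-trans (s≤s (≤-trans (≤-reflexive (+-identityʳ (suc k))) k<m))
                                            (m<m+n (suc r) (≤-trans 1≤j j≤s))))
                  (≤-trans (≤-reflexive (M-emptyʳ {none} {gt} (suc k))) z≤n)
  upper : M lt ρ (suc (r ∸ k)) s ≤ M none ρ (suc r ∸ k) s
  upper = subst (λ m′ → M lt ρ (suc (r ∸ k)) s ≤ M none ρ m′ s) (sym 1+r∸k)
                (M-mono (suc (r ∸ k)) s ≼-none ≼-refl)
drop-b₁-splitting {ρ} {r} {s} ih _ _ (split-A k (suc (suc q)) k∈ _ q<n sep adm) =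
  _ , split-A k (suc q) k∈ (s≤s z≤n) (s≤s⁻¹ q<n) (⊎-map (map₂ s≤s⁻¹) (map₂ s≤s⁻¹) sep)
        (admissible-drop-b₁ (true ∷_) (λ {t} {v} _ → ++∷≢[] t true v) adm) ,
  +-monoˡ-≤ (M lt ρ (suc (suc r ∸ k)) (s ∸ suc q))
            (ih gt k (suc q) (proj₁ (split-A-sizes k∈ (s≤s z≤n) (s≤s⁻¹ q<n))))
drop-b₁-splitting _ _ _ (split-B _ zero _ _ (() , _) _ _)
drop-b₁-splitting _ _ _ (split-B p 1 1≤p _ _ _ adm) = ⊥-elim (admissible-gt-empty (false ∷_) 1≤p adm)
drop-b₁-splitting {ρ} {r} {s} ih _ _ (split-B p (suc (suc k)) 1≤p p<m (_ , k<n) sep adm) =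
  _ , split-B p (suc k) 1≤p p<m k∈ (⊎-map (map₂ s≤s⁻¹) (map₂ s≤s⁻¹) sep)
        (admissible-drop-b₁ (false ∷_) (λ {t} {v} _ → ++∷≢[] t false v) adm) ,
  +-monoˡ-≤ (M gt ρ (suc r ∸ p) (suc (s ∸ suc k))) (ih lt p (suc k) (proj₁ (split-B-sizes 1≤p p<m k∈)))
  where
  k∈ : suc k ∈[1, s ]
  k∈ = s≤s z≤n , s≤s⁻¹ k<n

M-gt≤M-none : ∀ ρ r s → M gt ρ r (suc s) ≤ M none ρ r s
M-gt≤M-none ρ r s = go ρ r s (<-wellFounded (r + s))
  where
  go : ∀ ρ r s → Acc _<_ (r + s) → M gt ρ r (suc s) ≤ M none ρ r s
  go ρ zero    s _         = ≤-trans (≤-reflexive (M-emptyˡ {gt} {ρ} (suc s))) z≤n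
  go ρ (suc r) s (acc rec) =
    [ (λ det → ≤-trans (≤-reflexive (M-determined {gt} {ρ} {suc r} {suc s} det)) z≤n)
    , (λ und → via (M-attained {none} {ρ} {suc r} {s} (≤-trans und (countSat-gt ρ r s))))
    ]′ (determined? gt ρ (suc r) (suc s))
    where
    ih : ∀ ρ′ p q → p + q < suc r + s → M gt ρ′ p (suc q) ≤ M none ρ′ p q
    ih ρ′ p q p+q< = go ρ′ p q (rec p+q<)
    via : OptimalComparison none ρ (suc r) s → M gt ρ (suc r) (suc s) ≤ M none ρ (suc r) s
    via opt = begin
      M gt ρ (suc r) (suc s) ≤⟨ M-≤ i∈ (s≤s z≤n , s≤s (≤m j∈)) bound ⟩
      suc K                  ≡⟨ M≡1+K ⟨
      M none ρ (suc r) s     ∎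
      where
      open OptimalComparison opt
      open ≤-Reasoning
      bound : ∀ {x} → Splitting M gt ρ (suc r) (suc s) i (suc j) x → x ≤ K
      bound sp = let _ , sp′ , x≤y = drop-b₁-splitting ih i∈ j∈ sp in ≤-trans x≤y (bounded sp′)

-- Growth of the unconstrained function

GrowsBy2 : ℕ → ℕ → Set
GrowsBy2 m n = M none none m n + 2 ≤ M none none (suc m) (suc n)

GrowsBy2Below : ℕ → ℕ → Set
GrowsBy2Below m n = ∀ m′ n′ → m′ + n′ < m + n → 1 ≤ m′ + n′ → GrowsBy2 m′ n′

none-splitting-S : ∀ {m n i j p q} → p ≤ m → q ≤ n → SeparatedS i j p q →
                   Splitting M none none m n i j (M none none p q + M none none (m ∸ p) (n ∸ q))
none-splitting-S p≤m q≤n sep = split-S _ _ p≤m q≤n sep admissible-none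

none-splitting : ∀ {m n i j} → i ∈[1, m ] → j ∈[1, n ] → ∃[ x ] Splitting M none none m n i j x
none-splitting {j = suc j} (_ , i≤m) (_ , j<n) =
  _ , none-splitting-S i≤m (<⇒≤ j<n) (inj₁ (≤-refl , ≤-refl))

M-none-positive : ∀ a b → 1 ≤ M none none (suc a) (suc b)
M-none-positive a b = M-≥ {none} {none} {suc a} {suc b} (countSat-none a b)
  (λ i∈ j∈ → let _ , s = none-splitting i∈ j∈ in _ , s , z≤n)

M-none-suc∸ : ∀ {m n p q} → p ≤ m → q ≤ n →
              M none none (suc (m ∸ p)) (suc (n ∸ q)) ≡ M none none (suc m ∸ p) (suc n ∸ q)
M-none-suc∸ p≤m q≤n = sym (cong₂ (M none none) (+-∸-assoc 1 p≤m) (+-∸-assoc 1 q≤n))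

extend-upper-part : ∀ {m n i j x} → GrowsBy2Below m n → i ∈[1, m ] → j ∈[1, n ] →
                    Splitting M none none m n i j x →
                    ∃[ y ] Splitting M none none (suc m) (suc n) i j y × 2 + x ≤ y
extend-upper-part {m} {n} ih i∈ j∈ (split-S p q p≤m q≤n sep _) =
  _ , none-splitting-S (m≤n⇒m≤1+n p≤m) (m≤n⇒m≤1+n q≤n) sep ,
  +-mono-≤+2ʳ ≤-refl (begin
    M none none (m ∸ p) (n ∸ q) + 2
      ≤⟨ ih (m ∸ p) (n ∸ q) (proj₂ (split-S-sizes i∈ j∈ p≤m q≤n sep)) (separatedS⇒upper-positive i∈ j∈ sep) ⟩
    M none none (suc (m ∸ p)) (suc (n ∸ q))
      ≡⟨ M-none-suc∸ p≤m q≤n ⟩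
    M none none (suc m ∸ p) (suc n ∸ q) ∎)
  where open ≤-Reasoning
extend-upper-part {m} {n} ih _ _ (split-A k q k∈@(_ , k≤m) 1≤q q<n sep _) =
  _ , none-splitting-S (m≤n⇒m≤1+n k≤m) (m≤n⇒m≤1+n (<⇒≤ q<n)) (separatedA⇒S sep) ,
  +-mono-≤+2ʳ (M-mono k q ≼-refl ≼-none) (begin
    M lt none (suc (m ∸ k)) (n ∸ q) + 2
      ≤⟨ +-monoˡ-≤ 2 (M-lt≤M-none none (m ∸ k) (n ∸ q)) ⟩
    M none none (m ∸ k) (n ∸ q) + 2
      ≤⟨ ih (m ∸ k) (n ∸ q) (≤-trans (n≤1+n _) (proj₂ (split-A-sizes k∈ 1≤q q<n)))
                            (≤-trans (m<n⇒0<n∸m q<n) (m≤n+m (n ∸ q) (m ∸ k))) ⟩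
    M none none (suc (m ∸ k)) (suc (n ∸ q))
      ≡⟨ M-none-suc∸ k≤m (<⇒≤ q<n) ⟩
    M none none (suc m ∸ k) (suc n ∸ q) ∎)
  where open ≤-Reasoning
extend-upper-part {m} {n} ih _ _ (split-B p l 1≤p p<m l∈@(_ , l≤n) sep _) =
  _ , none-splitting-S (m≤n⇒m≤1+n (<⇒≤ p<m)) (m≤n⇒m≤1+n l≤n) (separatedB⇒S sep) ,
  +-mono-≤+2ʳ (M-mono p l ≼-refl ≼-none) (begin
    M gt none (m ∸ p) (suc (n ∸ l)) + 2
      ≤⟨ +-monoˡ-≤ 2 (M-gt≤M-none none (m ∸ p) (n ∸ l)) ⟩
    M none none (m ∸ p) (n ∸ l) + 2
      ≤⟨ ih (m ∸ p) (n ∸ l) (<-trans (+-monoʳ-< (m ∸ p) (n<1+n _)) (proj₂ (split-B-sizes 1≤p p<m l∈)))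
                            (≤-trans (m<n⇒0<n∸m p<m) (m≤m+n (m ∸ p) (n ∸ l))) ⟩
    M none none (suc (m ∸ p)) (suc (n ∸ l))
      ≡⟨ M-none-suc∸ (<⇒≤ p<m) l≤n ⟩
    M none none (suc m ∸ p) (suc n ∸ l) ∎)
  where open ≤-Reasoning

extend-lower-part : ∀ {m n i j x} → GrowsBy2Below m n → i ∈[1, m ] → j ∈[1, n ] →
                    Splitting M none none m n i j x →
                    ∃[ y ] Splitting M none none (suc m) (suc n) (suc i) (suc j) y × 2 + x ≤ y
extend-lower-part ih i∈@(1≤i , _) j∈@(1≤j , _) (split-S p q p≤m q≤n sep _) =
  _ , none-splitting-S (s≤s p≤m) (s≤s q≤n) (separatedS-shift sep) ,
  +-mono-≤+2ˡ (ih p q (proj₁ (split-S-sizes i∈ j∈ p≤m q≤n sep)) (separatedS⇒positive 1≤i 1≤j sep)) ≤-refl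
extend-lower-part {m} {n} ih _ _ (split-A k q k∈@(1≤k , k≤m) 1≤q q<n sep _) =
  _ , none-splitting-S (s≤s k≤m) (s≤s (<⇒≤ q<n)) (separatedS-shift (separatedA⇒S sep)) ,
  +-mono-≤+2ˡ (≤-trans (+-monoˡ-≤ 2 (M-mono k q ≼-refl ≼-none))
                       (ih k q (proj₁ (split-A-sizes k∈ 1≤q q<n)) (≤-trans 1≤k (m≤m+n k q))))
              (M-lt≤M-none none (m ∸ k) (n ∸ q))
extend-lower-part {m} {n} ih _ _ (split-B p l 1≤p p<m l∈ sep _) =
  _ , none-splitting-S (s≤s (<⇒≤ p<m)) (s≤s (≤m l∈)) (separatedS-shift (separatedB⇒S sep)) ,
  +-mono-≤+2ˡ (≤-trans (+-monoˡ-≤ 2 (M-mono p l ≼-refl ≼-none))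
                       (ih p l (proj₁ (split-B-sizes 1≤p p<m l∈)) (≤-trans 1≤p (m≤m+n p l))))
              (M-gt≤M-none none (m ∸ p) (n ∸ l))

grows-emptyˡ : ∀ n → GrowsBy2 0 (suc n)
grows-emptyˡ n =
  ≤-trans (≤-reflexive (cong (_+ 2) (M-emptyˡ {none} {none} (suc n))))
          (M-≥ {none} {none} {1} {suc (suc n)} (countSat-none 0 (suc n)) splitting)
  where
  splitting : ∀ {i j} → i ∈[1, 1 ] → j ∈[1, suc (suc n) ] →
              ∃[ x ] Splitting M none none 1 (suc (suc n)) i j x × 1 ≤ x
  splitting {j = suc zero} (1≤i , _) _ =
    _ , none-splitting-S z≤n (s≤s z≤n) (inj₂ (1≤i , ≤-refl)) ,
    ≤-trans (M-none-positive 0 n) (m≤n+m _ _)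
  splitting {j = suc (suc j)} (_ , i≤1) (_ , j<n) =
    _ , none-splitting-S ≤-refl (m≤n⇒m≤1+n (s≤s⁻¹ j<n)) (inj₁ (i≤1 , ≤-refl)) ,
    ≤-trans (M-none-positive 0 j) (m≤m+n _ _)

grows-emptyʳ : ∀ m → GrowsBy2 (suc m) 0
grows-emptyʳ m =
  ≤-trans (≤-reflexive (cong (_+ 2) (M-emptyʳ {none} {none} (suc m))))
          (M-≥ {none} {none} {suc (suc m)} {1} (countSat-none (suc m) 0) splitting)
  where
  splitting : ∀ {i j} → i ∈[1, suc (suc m) ] → j ∈[1, 1 ] →
              ∃[ x ] Splitting M none none (suc (suc m)) 1 i j x × 1 ≤ x
  splitting {i = suc zero} _ (1≤j , _) =
    _ , none-splitting-S (s≤s z≤n) z≤n (inj₁ (≤-refl , 1≤j)) ,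
    ≤-trans (M-none-positive m 0) (m≤n+m _ _)
  splitting {i = suc (suc i)} (_ , i<m) (_ , j≤1) =
    _ , none-splitting-S (m≤n⇒m≤1+n (s≤s⁻¹ i<m)) ≤-refl (inj₂ (≤-refl , j≤1)) ,
    ≤-trans (M-none-positive i 0) (m≤m+n _ _)

grows-nonempty : ∀ m n → GrowsBy2Below (suc m) (suc n) → GrowsBy2 (suc m) (suc n)
grows-nonempty m n ih =
  ≤-trans (≤-reflexive (+-comm Mₘₙ 2))
          (M-≥ {none} {none} {suc (suc m)} {suc (suc n)} (countSat-none (suc m) (suc n)) comparison)
  where
  Mₘₙ : ℕ
  Mₘₙ = M none none (suc m) (suc n)
  Goal : ℕ → ℕ → Set
  Goal i j = ∃[ y ] Splitting M none none (suc (suc m)) (suc (suc n)) i j y × suc Mₘₙ ≤ y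
  via-extension : ∀ {i j i′ j′} → i ∈[1, suc m ] → j ∈[1, suc n ] →
                  (∀ {x} → Splitting M none none (suc m) (suc n) i j x →
                     ∃[ y ] Splitting M none none (suc (suc m)) (suc (suc n)) i′ j′ y × 2 + x ≤ y) →
                  Goal i′ j′
  via-extension i∈ j∈ extend =
    let _ , s₀ = none-splitting i∈ j∈
        _ , s , M≤1+x = M-≤-splitting i∈ j∈ s₀
        _ , s′ , 2+x≤y = extend s
    in _ , s′ , ≤-trans (s≤s M≤1+x) 2+x≤y
  -- a₁ : b_j with j > n + 1 and a_i : b₁ with i > m + 1 split off a 1 × 1 problem.
  first-a-last-b : ∀ {j} → 1 < j → Goal 1 j
  first-a-last-b 1<j =
    _ , none-splitting-S (s≤s z≤n) (s≤s z≤n) (inj₁ (≤-refl , 1<j)) , +-monoˡ-≤ Mₘₙ (M-none-positive 0 0)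
  last-a-first-b : ∀ {i} → suc m < i → Goal i 1
  last-a-first-b m<i = _ , none-splitting-S (n≤1+n _) (n≤1+n _) (inj₂ (m<i , s≤s z≤n)) ,
    ≤-trans (≤-reflexive (+-comm 1 Mₘₙ)) (+-monoʳ-≤ Mₘₙ (subst (1 ≤_) M₁₁≡ (M-none-positive 0 0)))
    where
    M₁₁≡ : M none none 1 1 ≡ M none none (suc m ∸ m) (suc n ∸ n)
    M₁₁≡ = sym (cong₂ (M none none) (m+n∸n≡m 1 m) (m+n∸n≡m 1 n))
  inner : ∀ {i j} → i ∈[1, suc m ] → j ∈[1, suc n ] → Goal i j
  inner i∈ j∈ = via-extension i∈ j∈ (extend-upper-part ih i∈ j∈)
  shifted : ∀ {i j} → i ∈[1, suc m ] → j ∈[1, suc n ] → Goal (suc i) (suc j)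
  shifted i∈ j∈ = via-extension i∈ j∈ (extend-lower-part ih i∈ j∈)
  comparison : ∀ {i j} → i ∈[1, suc (suc m) ] → j ∈[1, suc (suc n) ] → Goal i j
  comparison {zero}        (() , _) _
  comparison {suc _} {zero} _ (() , _)
  comparison {1} {j} _ (1≤j , _) =
    [ (λ j≤n → inner (≤-refl , s≤s z≤n) (1≤j , j≤n)) , (λ n<j → first-a-last-b (≤-trans (s≤s (s≤s z≤n)) n<j)) ]′
    (≤-<-connex j (suc n))
  comparison {suc (suc i)} {1} _ _ =
    [ (λ i≤m → inner (s≤s z≤n , i≤m) (≤-refl , s≤s z≤n)) , last-a-first-b ]′ (≤-<-connex (suc (suc i)) (suc m))
  comparison {suc (suc i)} {suc (suc j)} (_ , i<) (_ , j<) = shifted (s≤s z≤n , s≤s⁻¹ i<) (s≤s z≤n , s≤s⁻¹ j<)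

lemma3 : (m n : ℕ) → 1 ≤ m + n → M none none m n + 2 ≤ M none none (suc m) (suc n)
lemma3 m n = go m n (<-wellFounded (m + n))
  where
  go : ∀ m n → Acc _<_ (m + n) → 1 ≤ m + n → GrowsBy2 m n
  go zero    (suc n) _         _ = grows-emptyˡ n
  go (suc m) zero    _         _ = grows-emptyʳ m
  go (suc m) (suc n) (acc rec) _ = grows-nonempty m n (λ m′ n′ lt → go m′ n′ (rec lt))
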